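{- Let $k\ge4$, let $H$ be the $k$-th power of the Hamilton cycle on $[n]$, and let $H_s$ be the subgraph of $H$ induced by $[s]$. Then the automorphism group of $H_s$ has exactly $2$ elements for every $s$ with $2k+1\le s<n$.
   Context: $H$ has vertex set $[n]$ and edges $\{v,v+i\}$ for $v\in[n]$, $i\in[k]$ (addition modulo $n$); $n$ is sufficiently large. -}

module Defs where

open import Data.Nat using (ℕ; _+_; _≤_; NonZero)
open import Data.Nat.DivMod using (_%_)
open import Data.Fin using (Fin; toℕ)
open import Data.Fin.Permutation using (Permutation′; _⟨$⟩ʳ_)
open import Data.Product using (Σ; ∃; _×_; _,_)
open import Data.Sum using (_⊎_)
open import Relation.Nullary using (¬_)
open import Relation.Binary.PropositionalEquality using (_≡_; _≢_)
open import Function.Bundles using (_⇔_)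

-- Vertices of H = C_n^k are 0,1,…,n-1 (i.e. [n] shifted by one);
-- {u,v} is an edge iff u ≠ v and v ≡ u + i or u ≡ v + i (mod n) for some 1 ≤ i ≤ k.
HAdj : (n k : ℕ) .{{_ : NonZero n}} → ℕ → ℕ → Set
HAdj n k u v =
  (u ≢ v) ×
  (Σ ℕ λ i → (1 ≤ i) × (i ≤ k) × ((v ≡ (u + i) % n) ⊎ (u ≡ (v + i) % n)))

HsAdj : (n k s : ℕ) .{{_ : NonZero n}} → Fin s → Fin s → Set
HsAdj n k s x y = HAdj n k (toℕ x) (toℕ y)

IsAut : (n k s : ℕ) .{{_ : NonZero n}} → Permutation′ s → Set
IsAut n k s σ = ∀ x y → HsAdj n k s x y ⇔ HsAdj n k s (σ ⟨$⟩ʳ x) (σ ⟨$⟩ʳ y)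

SamePerm : ∀ {s} → Permutation′ s → Permutation′ s → Set
SamePerm σ τ = ∀ x → σ ⟨$⟩ʳ x ≡ τ ⟨$⟩ʳ x

AutHasTwoElements : (n k s : ℕ) .{{_ : NonZero n}} → Set
AutHasTwoElements n k s =
  Σ (Permutation′ s) λ σ₁ → Σ (Permutation′ s) λ σ₂ →
    IsAut n k s σ₁ × IsAut n k s σ₂ × ¬ SamePerm σ₁ σ₂ ×
    (∀ τ → IsAut n k s τ → SamePerm τ σ₁ ⊎ SamePerm τ σ₂)

{-# OPTIONS --safe #-}
-- Call adjacent vertices u, v tight when each of N[u] ∖ N[v] and N[v] ∖ N[u] has at most
-- one element; automorphisms map tight pairs to tight pairs. In H_s (vertices 0, …, s − 1)
-- consecutive vertices are tight, and the only other possible tight pair is {k − 1, k + 1}: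
-- every other edge has two private neighbours on one side (n ≥ 3k + 1 keeps the
-- wrap-around edges of H_s away from these neighbours). So 0 has a single tight neighbour
-- while every inner vertex has two, and an automorphism τ sends 0 to 0 or to s − 1. After
-- composing with the reflection x ↦ s − 1 − x we may assume τ fixes 0, and walking along
-- the tight path 0, 1, 2, … shows that τ fixes every vertex: the exceptional pair cannot
-- be used, because 0 is adjacent to k but not to k + 1.
module Submission where

open import Data.Empty using (⊥; ⊥-elim)
open import Data.Fin using (Fin; zero; suc; toℕ; fromℕ<; opposite)
open import Data.Fin.Permutation using (Permutation′; _⟨$⟩ʳ_; _⟨$⟩ˡ_; _∘ₚ_; id; reverse; inverseʳ)
open import Data.Fin.Properties
  using (toℕ<n; toℕ-injective; toℕ-fromℕ; toℕ-fromℕ<; opposite-prop; opposite-involutive)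
open import Data.List using (_∷_; [])
open import Data.Nat using (ℕ; zero; suc; _+_; _*_; _∸_; _≤_; _<_; _≤?_; _<?_; z≤n; s≤s; z<s; NonZero)
open import Data.Nat.DivMod using (_%_; m<n⇒m%n≡m; [m+n]%n≡m%n; m≤n⇒[n∸m]%m≡n%m)
open import Data.Nat.Properties
open import Data.Nat.Tactic.RingSolver using (solve)
open import Data.Product using (Σ; ∃; _×_; _,_)
open import Data.Sum using (_⊎_; inj₁; inj₂; swap) renaming (map to ⊎-map)
open import Function using (_∘_; _⇔_; mk⇔; _↔_; Inverse; Injection; Equivalence)
open import Function.Construct.Composition using (_↔-∘_; _⇔-∘_)
open import Function.Construct.Identity using (↔-id)
open import Function.Properties.Inverse using (↔⇒↣)
open import Relation.Binary.PropositionalEquality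
open import Relation.Nullary using (¬_; yes; no)

open import Defs

infixr 5 _⊕_
_⊕_ : ∀ {a b c d} → a ≤ b → c ≤ d → a + c ≤ b + d
_⊕_ = +-mono-≤

-- Linear arithmetic by certificate: the hypotheses are summed into X ≤ Y,
-- and the ring solver checks the identity Q + X ≡ P + Y + c for a slack c.
≤-certified : ∀ {P Q X Y : ℕ} c → X ≤ Y → Q + X ≡ P + Y + c → P ≤ Q
≤-certified {P} {Q} {X} {Y} c X≤Y eq = +-cancelʳ-≤ Y P Q (begin
  P + Y      ≤⟨ m≤m+n (P + Y) c ⟩
  P + Y + c  ≡⟨ sym eq ⟩
  Q + X      ≤⟨ +-monoʳ-≤ Q X≤Y ⟩
  Q + Y      ∎)
  where open ≤-Reasoning

module Tightness {V : Set} (_~_ : V → V → Set) where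

  _∈N[_] : V → V → Set
  w ∈N[ v ] = w ≡ v ⊎ v ~ w

  Private : V → V → V → Set
  Private u v w = w ∈N[ u ] × ¬ w ∈N[ v ]

  AtMostOne : (V → Set) → Set
  AtMostOne P = ∀ {w w′} → P w → P w′ → w ≡ w′

  Tight : V → V → Set
  Tight u v = u ~ v × AtMostOne (Private u v) × AtMostOne (Private v u)

  tight-sym : (∀ {u v} → u ~ v → v ~ u) → ∀ {u v} → Tight u v → Tight v u
  tight-sym ~-sym (u~v , unique-uv , unique-vu) = ~-sym u~v , unique-vu , unique-uv

  Preserves : V ↔ V → Set
  Preserves π = ∀ x y → x ~ y ⇔ Inverse.to π x ~ Inverse.to π y

  preserves-id : Preserves (↔-id V)
  preserves-id x y = mk⇔ (λ x~y → x~y) (λ x~y → x~y)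

  preserves-∘ : ∀ π ρ → Preserves π → Preserves ρ → Preserves (ρ ↔-∘ π)
  preserves-∘ _ _ π-adj ρ-adj x y = ρ-adj _ _ ⇔-∘ π-adj x y

  module _ (π : V ↔ V) (π-adj : Preserves π) where
    open Inverse π

    private
      to-injective : ∀ {x y} → to x ≡ to y → x ≡ y
      to-injective = Injection.injective (↔⇒↣ π)

    ∈N-preserved : ∀ {v w} → w ∈N[ v ] ⇔ to w ∈N[ to v ]
    ∈N-preserved {v} {w} = mk⇔ (⊎-map (cong to) (Equivalence.to (π-adj v w)))
                               (⊎-map to-injective (Equivalence.from (π-adj v w)))

    private-preserved : ∀ {u v w} → Private u v w ⇔ Private (to u) (to v) (to w)
    private-preserved = mk⇔
      (λ (w∈u , w∉v) → Equivalence.to ∈N-preserved w∈u , w∉v ∘ Equivalence.from ∈N-preserved)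
      (λ (w∈u , w∉v) → Equivalence.from ∈N-preserved w∈u , w∉v ∘ Equivalence.to ∈N-preserved)

    atMostOne-preserved : ∀ {u v} → AtMostOne (Private u v) ⇔ AtMostOne (Private (to u) (to v))
    atMostOne-preserved {u} {v} = mk⇔ forward backward
      where
      pull : ∀ {w} → Private (to u) (to v) w → Private u v (from w)
      pull {w} = Equivalence.from private-preserved
               ∘ subst (Private (to u) (to v)) (sym (strictlyInverseˡ w))

      forward : AtMostOne (Private u v) → AtMostOne (Private (to u) (to v))
      forward unique {w} {w′} pw pw′ = begin
        w             ≡⟨ strictlyInverseˡ w ⟨
        to (from w)   ≡⟨ cong to (unique (pull pw) (pull pw′)) ⟩
        to (from w′)  ≡⟨ strictlyInverseˡ w′ ⟩
        w′            ∎
        where open ≡-Reasoning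

      backward : AtMostOne (Private (to u) (to v)) → AtMostOne (Private u v)
      backward unique pw pw′ =
        to-injective (unique (Equivalence.to private-preserved pw) (Equivalence.to private-preserved pw′))

    tight-preserved : ∀ {u v} → Tight u v ⇔ Tight (to u) (to v)
    tight-preserved {u} {v} = mk⇔
      (λ (u~v , unique-uv , unique-vu) → Equivalence.to (π-adj u v) u~v ,
         Equivalence.to atMostOne-preserved unique-uv , Equivalence.to atMostOne-preserved unique-vu)
      (λ (u~v , unique-uv , unique-vu) → Equivalence.from (π-adj u v) u~v ,
         Equivalence.from atMostOne-preserved unique-uv , Equivalence.from atMostOne-preserved unique-vu)

module CirculantAdjacency (n k : ℕ) .{{_ : NonZero n}} (k<n : k < n) where

  Step : ℕ → ℕ → Set
  Step u v = (u < v × v ≤ u + k) ⊎ v + n ≤ u + k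

  Adj : ℕ → ℕ → Set
  Adj u v = Step u v ⊎ Step v u

  adj-sym : ∀ {u v} → Adj u v → Adj v u
  adj-sym = swap

  step-irrefl : ∀ {u} → ¬ Step u u
  step-irrefl (inj₁ (u<u , _))   = <-irrefl refl u<u
  step-irrefl {u} (inj₂ u+n≤u+k) = <⇒≱ k<n (+-cancelˡ-≤ u n k u+n≤u+k)

  adj-irrefl : ∀ {u} → ¬ Adj u u
  adj-irrefl (inj₁ st) = step-irrefl st
  adj-irrefl (inj₂ st) = step-irrefl st

  %-wrap : ∀ {w} → n ≤ w → w < n + n → w % n + n ≡ w
  %-wrap {w} n≤w w<n+n = begin
    w % n + n        ≡⟨ cong (_+ n) (m≤n⇒[n∸m]%m≡n%m n≤w) ⟨
    (w ∸ n) % n + n  ≡⟨ cong (_+ n) (m<n⇒m%n≡m (m<n+o⇒m∸n<o w n w<n+n)) ⟩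
    w ∸ n + n        ≡⟨ m∸n+n≡m n≤w ⟩
    w                ∎
    where open ≡-Reasoning

  offset⇒step : ∀ {u v i} → u < n → 1 ≤ i → i ≤ k → v ≡ (u + i) % n → Step u v
  offset⇒step {u} {_} {i} u<n 1≤i i≤k refl with u + i <? n
  ... | yes u+i<n rewrite m<n⇒m%n≡m u+i<n = inj₁ (m<m+n u 1≤i , +-monoʳ-≤ u i≤k)
  ... | no  u+i≮n = inj₂ (begin
    (u + i) % n + n  ≡⟨ %-wrap (≮⇒≥ u+i≮n) (+-mono-< u<n (≤-<-trans i≤k k<n)) ⟩
    u + i            ≤⟨ +-monoʳ-≤ u i≤k ⟩
    u + k            ∎)
    where open ≤-Reasoning

  offset : ∀ {u w v} → u < w → w ≤ u + k → v ≡ w % n → ∃ λ i → 1 ≤ i × i ≤ k × v ≡ (u + i) % n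
  offset {u} {w} u<w w≤u+k v≡w%n =
    w ∸ u , m<n⇒0<n∸m u<w , m≤n+o⇒m∸n≤o w u w≤u+k ,
    trans v≡w%n (cong (_% n) (sym (m+[n∸m]≡n (<⇒≤ u<w))))

  step⇒offset : ∀ {u v} → u < n → v < n → Step u v → ∃ λ i → 1 ≤ i × i ≤ k × v ≡ (u + i) % n
  step⇒offset _ v<n (inj₁ (u<v , v≤u+k)) =
    offset u<v v≤u+k (sym (m<n⇒m%n≡m v<n))
  step⇒offset {u} {v} u<n v<n (inj₂ v+n≤u+k) =
    offset (<-≤-trans u<n (m≤n+m n v)) v+n≤u+k (sym (trans ([m+n]%n≡m%n v n) (m<n⇒m%n≡m v<n)))

  hAdj⇔adj : ∀ {u v} → u < n → v < n → HAdj n k u v ⇔ Adj u v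
  hAdj⇔adj {u} {v} u<n v<n = mk⇔ to from
    where
    to : HAdj n k u v → Adj u v
    to (_ , i , 1≤i , i≤k , inj₁ v≡u+i) = inj₁ (offset⇒step u<n 1≤i i≤k v≡u+i)
    to (_ , i , 1≤i , i≤k , inj₂ u≡v+i) = inj₂ (offset⇒step v<n 1≤i i≤k u≡v+i)

    from : Adj u v → HAdj n k u v
    from adj = (λ u≡v → adj-irrefl (subst (Adj u) (sym u≡v) adj)) , offsets adj
      where
      offsets : Adj u v → ∃ λ i → 1 ≤ i × i ≤ k × (v ≡ (u + i) % n ⊎ u ≡ (v + i) % n)
      offsets (inj₁ st) = let i , 1≤i , i≤k , eq = step⇒offset u<n v<n st in i , 1≤i , i≤k , inj₁ eq
      offsets (inj₂ st) = let i , 1≤i , i≤k , eq = step⇒offset v<n u<n st in i , 1≤i , i≤k , inj₂ eq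

  step-mirror : ∀ {u u′ v v′} → u + u′ ≡ v + v′ → Step u v → Step v′ u′
  step-mirror {u} {u′} {v} {v′} eq (inj₁ (u<v , v≤u+k)) =
    inj₁ ( ≤-certified 0 (u<v ⊕ ≤-reflexive (sym eq)) (solve (u ∷ u′ ∷ v ∷ v′ ∷ []))
         , ≤-certified 0 (v≤u+k ⊕ ≤-reflexive eq) (solve (u ∷ u′ ∷ v ∷ v′ ∷ k ∷ [])))
  step-mirror {u} {u′} {v} {v′} eq (inj₂ v+n≤u+k) =
    inj₂ (≤-certified 0 (v+n≤u+k ⊕ ≤-reflexive eq) (solve (u ∷ u′ ∷ v ∷ v′ ∷ k ∷ n ∷ [])))

  adj-mirror : ∀ {u u′ v v′} → u + u′ ≡ v + v′ → Adj u v → Adj u′ v′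
  adj-mirror eq (inj₁ st) = inj₂ (step-mirror eq st)
  adj-mirror eq (inj₂ st) = inj₁ (step-mirror (sym eq) st)

module PrivateNeighbours (n k s : ℕ) .{{_ : NonZero n}}
  (4≤k : 4 ≤ k) (3k+1≤n : 3 * k + 1 ≤ n) (2k+1≤s : 2 * k + 1 ≤ s) (s<n : s < n) where

  0<k : 0 < k
  0<k = ≤-trans (s≤s z≤n) 4≤k

  k<n : k < n
  k<n = ≤-certified (2 * k) 3k+1≤n (solve (k ∷ n ∷ []))

  1<s : 1 < s
  1<s = ≤-certified (k + 3) (2k+1≤s ⊕ 4≤k) (solve (k ∷ s ∷ []))

  open CirculantAdjacency n k k<n public

  _∈Nℕ[_] : ℕ → ℕ → Set
  w ∈Nℕ[ u ] = w ≡ u ⊎ Adj u w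

  ∈Nℕ-sym : ∀ {u w} → w ∈Nℕ[ u ] → u ∈Nℕ[ w ]
  ∈Nℕ-sym = ⊎-map sym adj-sym

  Privateℕ : ℕ → ℕ → ℕ → Set
  Privateℕ a b w = w ∈Nℕ[ a ] × ¬ w ∈Nℕ[ b ]

  Pair : (ℕ → Set) → ℕ → Set
  Pair P p = P p × P (suc p)

  TwoPrivateℕ : ℕ → ℕ → Set
  TwoPrivateℕ a b = Σ ℕ λ p → suc p < s × Pair (Privateℕ a b) p

  Special : ℕ → ℕ → Set
  Special a b = suc a ≡ k × b ≡ suc k

  two-private : ∀ {a b p} → suc p < s → Pair (_∈Nℕ[ a ]) p → Pair (λ w → ¬ w ∈Nℕ[ b ]) p →
                TwoPrivateℕ a b
  two-private p+1<s (p∈ , p+1∈) (p∉ , p+1∉) = _ , p+1<s , (p∈ , p∉) , (p+1∈ , p+1∉)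

  pair-above : ∀ {u p} → u < p → suc p ≤ u + k → Pair (_∈Nℕ[ u ]) p
  pair-above u<p p+1≤u+k =
    inj₂ (inj₁ (inj₁ (u<p , ≤-trans (n≤1+n _) p+1≤u+k))) ,
    inj₂ (inj₁ (inj₁ (m<n⇒m<1+n u<p , p+1≤u+k)))

  pair-below : ∀ {u p} → suc p < u → u ≤ p + k → Pair (_∈Nℕ[ u ]) p
  pair-below p+1<u u≤p+k =
    inj₂ (inj₂ (inj₁ (<-trans (n<1+n _) p+1<u , u≤p+k))) ,
    inj₂ (inj₂ (inj₁ (p+1<u , m≤n⇒m≤1+n u≤p+k)))

  upper-pair : ∀ {u p} → suc p ≡ u + k → Pair (_∈Nℕ[ u ]) p
  upper-pair {u} {p} 1+p≡u+k = pair-above u<p (≤-reflexive 1+p≡u+k)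
    where
    u<p : u < p
    u<p = ≤-certified 2 (≤-reflexive (sym 1+p≡u+k) ⊕ 4≤k) (solve (u ∷ p ∷ k ∷ []))

  lower-pair : ∀ {p} → Pair (_∈Nℕ[ k + p ]) p
  lower-pair {p} = pair-below 1+p<k+p (≤-reflexive (+-comm k p))
    where
    1+p<k+p : suc p < k + p
    1+p<k+p = ≤-certified 2 4≤k (solve (k ∷ p ∷ []))

  far-above : ∀ {u w} → u + k < w → w + k < u + n → ¬ w ∈Nℕ[ u ]
  far-above {u} u+k<w _ (inj₁ refl)                        = m+n≮m u k u+k<w
  far-above u+k<w _ (inj₂ (inj₁ (inj₁ (_ , w≤u+k))))       = <⇒≱ u+k<w w≤u+k
  far-above {w = w} u+k<w _ (inj₂ (inj₁ (inj₂ w+n≤u+k)))   = m+n≮m w n (≤-<-trans w+n≤u+k u+k<w)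
  far-above {u} u+k<w _ (inj₂ (inj₂ (inj₁ (w<u , _))))     = <-asym w<u (≤-<-trans (m≤m+n u k) u+k<w)
  far-above _ w+k<u+n (inj₂ (inj₂ (inj₂ u+n≤w+k)))         = <⇒≱ w+k<u+n u+n≤w+k

  far-below : ∀ {u w} → w + k < u → u + k < w + n → ¬ w ∈Nℕ[ u ]
  far-below w+k<u u+k<w+n = far-above w+k<u u+k<w+n ∘ ∈Nℕ-sym

  pair-far-above : ∀ {u p} → u + k < p → suc p + k < u + n → Pair (λ w → ¬ w ∈Nℕ[ u ]) p
  pair-far-above u+k<p p+1+k<u+n =
    far-above u+k<p (<-trans (n<1+n _) p+1+k<u+n) , far-above (m<n⇒m<1+n u+k<p) p+1+k<u+n

  pair-far-below : ∀ {u p} → suc p + k < u → u + k < p + n → Pair (λ w → ¬ w ∈Nℕ[ u ]) p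
  pair-far-below p+1+k<u u+k<p+n =
    far-below (<-trans (n<1+n _) p+1+k<u) u+k<p+n , far-below p+1+k<u (m<n⇒m<1+n u+k<p+n)

  adj-ordered : ∀ {a b} → a < b → Adj a b → b ≤ a + k ⊎ a + n ≤ b + k
  adj-ordered _   (inj₁ (inj₁ (_ , b≤a+k))) = inj₁ b≤a+k
  adj-ordered a<b (inj₁ (inj₂ b+n≤a+k))     = ⊥-elim (<⇒≱ (+-mono-< a<b k<n) b+n≤a+k)
  adj-ordered a<b (inj₂ (inj₁ (b<a , _)))   = ⊥-elim (<-asym a<b b<a)
  adj-ordered _   (inj₂ (inj₂ a+n≤b+k))     = inj₂ a+n≤b+k

  two-private-wrap : ∀ {a b} → a + n ≤ b + k → b < s → TwoPrivateℕ b a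
  two-private-wrap {a} {b} a+n≤b+k b<s
    with m≤n⇒∃[o]m+o≡n (≤-certified {k} {b} (a + k + 1) (a+n≤b+k ⊕ 3k+1≤n) (solve (a ∷ b ∷ k ∷ n ∷ [])))
  ... | p , refl = two-private bound lower-pair (pair-far-above above-a below-a)
    where
    bound : suc p < s
    bound = ≤-certified 3 (b<s ⊕ 4≤k) (solve (k ∷ p ∷ s ∷ []))
    above-a : a + k < p
    above-a = ≤-certified 0 (a+n≤b+k ⊕ 3k+1≤n) (solve (a ∷ k ∷ p ∷ n ∷ []))
    below-a : suc p + k < a + n
    below-a = ≤-certified a (b<s ⊕ s<n) (solve (a ∷ k ∷ p ∷ n ∷ s ∷ []))

  two-private-below : ∀ {a b} → k ≤ a → suc (suc a) ≤ b → b ≤ a + k → b < s → TwoPrivateℕ a b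
  two-private-below {b = b} k≤a 2+a≤b b≤a+k b<s with m≤n⇒∃[o]m+o≡n k≤a
  ... | p , refl = two-private bound lower-pair (pair-far-below below-b above-b)
    where
    bound : suc p < s
    bound = ≤-certified (k + 1) (2+a≤b ⊕ b<s) (solve (b ∷ k ∷ p ∷ s ∷ []))
    below-b : suc p + k < b
    below-b = ≤-certified 0 2+a≤b (solve (b ∷ k ∷ p ∷ []))
    above-b : b + k < p + n
    above-b = ≤-certified 0 (b≤a+k ⊕ 3k+1≤n) (solve (b ∷ k ∷ p ∷ n ∷ []))

  two-private-above : ∀ {a b} → suc (suc a) ≤ b → b ≤ a + k → b + k < s → TwoPrivateℕ b a
  two-private-above {a} {b} 2+a≤b b≤a+k b+k<s with m≤n⇒∃[o]m+o≡n (<-≤-trans 0<k (m≤n+m k b))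
  ... | p , 1+p≡b+k = two-private bound (upper-pair 1+p≡b+k) (pair-far-above above-a below-a)
    where
    bound : suc p < s
    bound = subst (_< s) (sym 1+p≡b+k) b+k<s
    above-a : a + k < p
    above-a = ≤-certified 0 (2+a≤b ⊕ ≤-reflexive (sym 1+p≡b+k)) (solve (a ∷ b ∷ k ∷ p ∷ []))
    below-a : suc p + k < a + n
    below-a = ≤-certified 0 (≤-reflexive 1+p≡b+k ⊕ b≤a+k ⊕ 3k+1≤n) (solve (a ∷ b ∷ k ∷ p ∷ n ∷ []))

  two-private-start : ∀ {a b} → a < k → suc (suc k) ≤ b → b ≤ a + k → TwoPrivateℕ a b
  two-private-start {a} {b} a<k k+2≤b b≤a+k =
    two-private {p = 0} 1<s (pair-below 1<a (<⇒≤ a<k)) (pair-far-below k+2≤b b+k<n)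
    where
    1<a : 1 < a
    1<a = ≤-certified 0 (k+2≤b ⊕ b≤a+k) (solve (a ∷ b ∷ k ∷ []))
    b+k<n : b + k < n
    b+k<n = ≤-certified 1 (b≤a+k ⊕ a<k ⊕ 3k+1≤n) (solve (a ∷ b ∷ k ∷ n ∷ []))

  two-private-end : ∀ {a} → suc (suc a) ≤ k → TwoPrivateℕ (suc k) a
  two-private-end {a} 2+a≤k with m≤n⇒∃[o]m+o≡n (<-≤-trans 0<k (m≤n+m k k))
  ... | p , 1+p≡2k = two-private bound (pair-above 1+k<p (m≤n⇒m≤1+n (≤-reflexive 1+p≡2k)))
                                       (pair-far-above above-a below-a)
    where
    bound : suc p < s
    bound = ≤-certified 0 (2k+1≤s ⊕ ≤-reflexive 1+p≡2k) (solve (k ∷ p ∷ s ∷ []))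
    1+k<p : suc k < p
    1+k<p = ≤-certified 1 (≤-reflexive (sym 1+p≡2k) ⊕ 4≤k) (solve (k ∷ p ∷ []))
    above-a : a + k < p
    above-a = ≤-certified 0 (2+a≤k ⊕ ≤-reflexive (sym 1+p≡2k)) (solve (a ∷ k ∷ p ∷ []))
    below-a : suc p + k < a + n
    below-a = ≤-certified a (≤-reflexive 1+p≡2k ⊕ 3k+1≤n) (solve (a ∷ k ∷ p ∷ n ∷ []))

  squeezed⇒≡1+k : ∀ {b} → ¬ b + k < s → ¬ suc (suc k) ≤ b → b ≡ suc k
  squeezed⇒≡1+k {b} b+k≮s k+2≰b =
    ≤-antisym (≤-pred (≰⇒> k+2≰b)) (≤-certified 0 (≤-pred (≰⇒> b+k≮s) ⊕ 2k+1≤s) (solve (b ∷ k ∷ s ∷ [])))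

  adjacent-cases : ∀ {a b} → a < b → b < s → Adj a b →
                   b ≡ suc a ⊎ Special a b ⊎ TwoPrivateℕ a b ⊎ TwoPrivateℕ b a
  adjacent-cases {a} {b} a<b b<s adj with adj-ordered a<b adj
  ... | inj₂ a+n≤b+k = inj₂ (inj₂ (inj₂ (two-private-wrap a+n≤b+k b<s)))
  ... | inj₁ b≤a+k with m≤n⇒m<n∨m≡n a<b
  ... | inj₂ 1+a≡b = inj₁ (sym 1+a≡b)
  ... | inj₁ 2+a≤b with k ≤? a
  ... | yes k≤a = inj₂ (inj₂ (inj₁ (two-private-below k≤a 2+a≤b b≤a+k b<s)))
  ... | no  k≰a with b + k <? s
  ... | yes b+k<s = inj₂ (inj₂ (inj₂ (two-private-above 2+a≤b b≤a+k b+k<s)))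
  ... | no  b+k≮s with suc (suc k) ≤? b
  ... | yes k+2≤b = inj₂ (inj₂ (inj₁ (two-private-start (≰⇒> k≰a) k+2≤b b≤a+k)))
  ... | no  k+2≰b with squeezed⇒≡1+k b+k≮s k+2≰b
  ... | refl with suc (suc a) ≤? k
  ... | yes 2+a≤k = inj₂ (inj₂ (inj₂ (two-private-end 2+a≤k)))
  ... | no  2+a≰k = inj₂ (inj₁ (≤-antisym (≰⇒> k≰a) (≤-pred (≰⇒> 2+a≰k)) , refl))

  adj-suc : ∀ {a} → Adj a (suc a)
  adj-suc {a} = inj₁ (inj₁ (n<1+n a , m<m+n a 0<k))

  consecutive-private : ∀ {a w} → Privateℕ a (suc a) w → w + k ≡ a ⊎ w + k ≡ a + n
  consecutive-private {a} (w∈ , w∉) with w∈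
  ... | inj₁ refl = ⊥-elim (w∉ (inj₂ (adj-sym adj-suc)))
  ... | inj₂ (inj₁ (inj₁ (a<w , w≤a+k))) with m≤n⇒m<n∨m≡n a<w
  ...   | inj₁ 1+a<w = ⊥-elim (w∉ (inj₂ (inj₁ (inj₁ (1+a<w , m≤n⇒m≤1+n w≤a+k)))))
  ...   | inj₂ refl  = ⊥-elim (w∉ (inj₁ refl))
  consecutive-private (_ , w∉) | inj₂ (inj₁ (inj₂ w+n≤a+k)) =
    ⊥-elim (w∉ (inj₂ (inj₁ (inj₂ (m≤n⇒m≤1+n w+n≤a+k)))))
  consecutive-private (_ , w∉) | inj₂ (inj₂ (inj₁ (w<a , a≤w+k))) with m≤n⇒m<n∨m≡n a≤w+k
  ...   | inj₁ a<w+k = ⊥-elim (w∉ (inj₂ (inj₂ (inj₁ (m<n⇒m<1+n w<a , a<w+k)))))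
  ...   | inj₂ a≡w+k = inj₁ (sym a≡w+k)
  consecutive-private (_ , w∉) | inj₂ (inj₂ (inj₂ a+n≤w+k)) with m≤n⇒m<n∨m≡n a+n≤w+k
  ...   | inj₁ a+n<w+k = ⊥-elim (w∉ (inj₂ (inj₂ (inj₂ a+n<w+k))))
  ...   | inj₂ a+n≡w+k = inj₂ (sym a+n≡w+k)

  wrap-out-of-range : ∀ {a x y} → y < s → x + k ≡ a → y + k ≡ a + n → ⊥
  wrap-out-of-range {a} {x} {y} y<s x+k≡a y+k≡a+n = <⇒≱ (<-trans y<s s<n)
    (≤-certified x (≤-reflexive (sym y+k≡a+n) ⊕ ≤-reflexive x+k≡a) (solve (a ∷ x ∷ y ∷ k ∷ n ∷ [])))

  consecutive-private-unique : ∀ {a w w′} → w < s → w′ < s →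
    Privateℕ a (suc a) w → Privateℕ a (suc a) w′ → w ≡ w′
  consecutive-private-unique {w = w} {w′} w<s w′<s pw pw′
    with consecutive-private pw | consecutive-private pw′
  ... | inj₁ e | inj₁ e′ = +-cancelʳ-≡ k w w′ (trans e (sym e′))
  ... | inj₂ e | inj₂ e′ = +-cancelʳ-≡ k w w′ (trans e (sym e′))
  ... | inj₁ e | inj₂ e′ = ⊥-elim (wrap-out-of-range w′<s e e′)
  ... | inj₂ e | inj₁ e′ = ⊥-elim (wrap-out-of-range w<s e′ e)

  adj-0-k : Adj 0 k
  adj-0-k = inj₁ (inj₁ (0<k , ≤-refl))

  ¬adj-0-1+k : ¬ Adj 0 (suc k)
  ¬adj-0-1+k = far-above (n<1+n k) (≤-certified 3 (3k+1≤n ⊕ 4≤k) (solve (k ∷ n ∷ []))) ∘ inj₂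

module Automorphisms (n k m : ℕ) .{{_ : NonZero n}}
  (4≤k : 4 ≤ k) (3k+1≤n : 3 * k + 1 ≤ n) (2k+1≤s : 2 * k + 1 ≤ suc m) (s<n : suc m < n) where

  s : ℕ
  s = suc m

  open PrivateNeighbours n k s 4≤k 3k+1≤n 2k+1≤s s<n
  open Tightness (HsAdj n k s)

  vertex<n : (x : Fin s) → toℕ x < n
  vertex<n x = <-trans (toℕ<n x) s<n

  hsAdj⇔adj : ∀ {x y} → HsAdj n k s x y ⇔ Adj (toℕ x) (toℕ y)
  hsAdj⇔adj {x} {y} = hAdj⇔adj (vertex<n x) (vertex<n y)

  hsAdj-sym : ∀ {x y} → HsAdj n k s x y → HsAdj n k s y x
  hsAdj-sym = Equivalence.from hsAdj⇔adj ∘ adj-sym ∘ Equivalence.to hsAdj⇔adj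

  ∈N⇔∈Nℕ : ∀ {v w} → w ∈N[ v ] ⇔ toℕ w ∈Nℕ[ toℕ v ]
  ∈N⇔∈Nℕ = mk⇔ (⊎-map (cong toℕ) (Equivalence.to hsAdj⇔adj))
                (⊎-map toℕ-injective (Equivalence.from hsAdj⇔adj))

  private⇔privateℕ : ∀ {u v w} → Private u v w ⇔ Privateℕ (toℕ u) (toℕ v) (toℕ w)
  private⇔privateℕ = mk⇔
    (λ (w∈u , w∉v) → Equivalence.to ∈N⇔∈Nℕ w∈u , w∉v ∘ Equivalence.from ∈N⇔∈Nℕ)
    (λ (w∈u , w∉v) → Equivalence.from ∈N⇔∈Nℕ w∈u , w∉v ∘ Equivalence.to ∈N⇔∈Nℕ)

  atMostOne-fromℕ : ∀ {u v} →
    (∀ {p q} → p < s → q < s → Privateℕ (toℕ u) (toℕ v) p → Privateℕ (toℕ u) (toℕ v) q → p ≡ q) →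
    AtMostOne (Private u v)
  atMostOne-fromℕ unique pw pw′ = toℕ-injective
    (unique (toℕ<n _) (toℕ<n _) (Equivalence.to private⇔privateℕ pw) (Equivalence.to private⇔privateℕ pw′))

  twoPrivate⇒¬atMostOne : ∀ {u v} → TwoPrivateℕ (toℕ u) (toℕ v) → ¬ AtMostOne (Private u v)
  twoPrivate⇒¬atMostOne {u} {v} (p , p+1<s , private-p , private-p+1) unique =
    <⇒≢ (n<1+n p) (begin
      p                         ≡⟨ toℕ-fromℕ< p<s ⟨
      toℕ (fromℕ< p<s)          ≡⟨ cong toℕ (unique (lift p<s private-p) (lift p+1<s private-p+1)) ⟩
      toℕ (fromℕ< p+1<s)        ≡⟨ toℕ-fromℕ< p+1<s ⟩
      suc p                     ∎)
    where
    open ≡-Reasoning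
    p<s : p < s
    p<s = <-trans (n<1+n p) p+1<s
    lift : ∀ {q} (q<s : q < s) → Privateℕ (toℕ u) (toℕ v) q → Private u v (fromℕ< q<s)
    lift q<s = Equivalence.from private⇔privateℕ
             ∘ subst (Privateℕ (toℕ u) (toℕ v)) (sym (toℕ-fromℕ< q<s))

  toℕ+toℕ-opposite : (x : Fin s) → toℕ x + toℕ (opposite x) ≡ m
  toℕ+toℕ-opposite x = trans (cong (toℕ x +_) (opposite-prop x)) (m+[n∸m]≡n (≤-pred (toℕ<n x)))

  reverse-preserves : Preserves reverse
  reverse-preserves x y = mk⇔ (mirror x y)
    (subst₂ (HsAdj n k s) (opposite-involutive x) (opposite-involutive y) ∘ mirror (opposite x) (opposite y))
    where
    mirror : ∀ x y → HsAdj n k s x y → HsAdj n k s (opposite x) (opposite y)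
    mirror x y = Equivalence.from hsAdj⇔adj
               ∘ adj-mirror (trans (toℕ+toℕ-opposite x) (sym (toℕ+toℕ-opposite y)))
               ∘ Equivalence.to hsAdj⇔adj

  consecutive-left-unique : ∀ {x y} → toℕ y ≡ suc (toℕ x) → AtMostOne (Private x y)
  consecutive-left-unique {x} {y} y≡1+x = atMostOne-fromℕ unique
    where
    unique : ∀ {p q} → p < s → q < s → Privateℕ (toℕ x) (toℕ y) p → Privateℕ (toℕ x) (toℕ y) q → p ≡ q
    unique rewrite y≡1+x = consecutive-private-unique

  consecutive-tight : ∀ {x y} → toℕ y ≡ suc (toℕ x) → Tight x y
  consecutive-tight {x} {y} y≡1+x = x~y , consecutive-left-unique y≡1+x , y-unique
    where
    open ≡-Reasoning
    x~y : HsAdj n k s x y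
    x~y = Equivalence.from hsAdj⇔adj (subst (Adj (toℕ x)) (sym y≡1+x) adj-suc)
    mirrored : toℕ (opposite x) ≡ suc (toℕ (opposite y))
    mirrored = +-cancelˡ-≡ (toℕ x) _ _ (begin
      toℕ x + toℕ (opposite x)        ≡⟨ toℕ+toℕ-opposite x ⟩
      m                               ≡⟨ toℕ+toℕ-opposite y ⟨
      toℕ y + toℕ (opposite y)        ≡⟨ cong (_+ toℕ (opposite y)) y≡1+x ⟩
      suc (toℕ x) + toℕ (opposite y)  ≡⟨ +-suc (toℕ x) _ ⟨
      toℕ x + suc (toℕ (opposite y))  ∎)
    y-unique : AtMostOne (Private y x)
    y-unique = Equivalence.from (atMostOne-preserved reverse reverse-preserves)
                                (consecutive-left-unique mirrored)

  tight-shape : ∀ {x y} → Tight x y → toℕ x < toℕ y → toℕ y ≡ suc (toℕ x) ⊎ Special (toℕ x) (toℕ y)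
  tight-shape {x} {y} (x~y , unique-xy , unique-yx) x<y
    with adjacent-cases x<y (toℕ<n y) (Equivalence.to hsAdj⇔adj x~y)
  ... | inj₁ consecutive        = inj₁ consecutive
  ... | inj₂ (inj₁ special)     = inj₂ special
  ... | inj₂ (inj₂ (inj₁ two))  = ⊥-elim (twoPrivate⇒¬atMostOne two unique-xy)
  ... | inj₂ (inj₂ (inj₂ two))  = ⊥-elim (twoPrivate⇒¬atMostOne two unique-yx)

  tight-zero : ∀ {y} → Tight zero y → toℕ y ≡ 1
  tight-zero {zero} (0~0 , _) = ⊥-elim (adj-irrefl (Equivalence.to hsAdj⇔adj 0~0))
  tight-zero {suc y} t with tight-shape t z<s
  ... | inj₁ y≡0       = y≡0
  ... | inj₂ (1≡k , _) = ⊥-elim (<⇒≢ (≤-trans (s≤s (s≤s z≤n)) 4≤k) 1≡k)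

  module _ (τ : Permutation′ s) (τ-aut : IsAut n k s τ) where

    module _ (τ0≡0 : τ ⟨$⟩ʳ zero ≡ zero) where

      successor-fixed : ∀ {x y} → τ ⟨$⟩ʳ y ≡ y → toℕ x ≡ suc (toℕ y) → toℕ y < toℕ (τ ⟨$⟩ʳ x) →
                        τ ⟨$⟩ʳ x ≡ x
      successor-fixed {x} {y} τy≡y x≡1+y y<τx = by-shape (tight-shape tight-image y<τx)
        where
        tight-image : Tight y (τ ⟨$⟩ʳ x)
        tight-image = subst (λ z → Tight z (τ ⟨$⟩ʳ x)) τy≡y
                            (Equivalence.to (tight-preserved τ τ-aut) (consecutive-tight x≡1+y))

        0~τx : toℕ x ≡ k → HsAdj n k s zero (τ ⟨$⟩ʳ x)
        0~τx x≡k = subst (λ z → HsAdj n k s z (τ ⟨$⟩ʳ x)) τ0≡0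
          (Equivalence.to (τ-aut zero x) (Equivalence.from hsAdj⇔adj (subst (Adj 0) (sym x≡k) adj-0-k)))

        by-shape : toℕ (τ ⟨$⟩ʳ x) ≡ suc (toℕ y) ⊎ Special (toℕ y) (toℕ (τ ⟨$⟩ʳ x)) → τ ⟨$⟩ʳ x ≡ x
        by-shape (inj₁ τx≡1+y)           = toℕ-injective (trans τx≡1+y (sym x≡1+y))
        by-shape (inj₂ (1+y≡k , τx≡1+k)) =
          ⊥-elim (¬adj-0-1+k (subst (Adj 0) τx≡1+k (Equivalence.to hsAdj⇔adj (0~τx (trans x≡1+y 1+y≡k)))))

      FixesUpTo : ℕ → Set
      FixesUpTo i = ∀ x → toℕ x ≤ i → τ ⟨$⟩ʳ x ≡ x

      fixes-next : ∀ {i} → FixesUpTo i → ∀ x → toℕ x ≡ suc i → τ ⟨$⟩ʳ x ≡ x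
      fixes-next {i} fixed x x≡1+i with toℕ (τ ⟨$⟩ʳ x) ≤? i
      ... | yes τx≤i = Injection.injective (↔⇒↣ τ) (fixed (τ ⟨$⟩ʳ x) τx≤i)
      ... | no  τx≰i = successor-fixed (fixed y (≤-reflexive y≡i)) (trans x≡1+i (cong suc (sym y≡i)))
                                       (subst (_< toℕ (τ ⟨$⟩ʳ x)) (sym y≡i) (≰⇒> τx≰i))
        where
        i<s : i < s
        i<s = <-trans (n<1+n i) (subst (_< s) x≡1+i (toℕ<n x))
        y : Fin s
        y = fromℕ< i<s
        y≡i : toℕ y ≡ i
        y≡i = toℕ-fromℕ< i<s

      fixes-upTo : ∀ i → FixesUpTo i
      fixes-upTo zero    zero    _ = τ0≡0
      fixes-upTo (suc i) x x≤1+i with m≤n⇒m<n∨m≡n x≤1+i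
      ... | inj₁ x<1+i = fixes-upTo i x (≤-pred x<1+i)
      ... | inj₂ x≡1+i = fixes-next (fixes-upTo i) x x≡1+i

      fixes-all : SamePerm τ id
      fixes-all x = fixes-upTo (toℕ x) x ≤-refl

    interior-not-image-of-zero : ∀ {e} → toℕ (τ ⟨$⟩ʳ zero) ≡ suc e → suc (suc e) < s → ⊥
    interior-not-image-of-zero {e} τ0≡1+e 2+e<s = <⇒≢ (<-trans (n<1+n e) (n<1+n (suc e))) (begin
      e                 ≡⟨ toℕ-fromℕ< e<s ⟨
      toℕ u             ≡⟨ cong toℕ u≡v ⟩
      toℕ v             ≡⟨ toℕ-fromℕ< 2+e<s ⟩
      suc (suc e)       ∎)
      where
      open ≡-Reasoning
      e<s : e < s
      e<s = <-trans (n<1+n e) (<-trans (n<1+n (suc e)) 2+e<s)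
      c u v : Fin s
      c = τ ⟨$⟩ʳ zero
      u = fromℕ< e<s
      v = fromℕ< 2+e<s
      tight-u : Tight c u
      tight-u = tight-sym hsAdj-sym (consecutive-tight (trans τ0≡1+e (cong suc (sym (toℕ-fromℕ< e<s)))))
      tight-v : Tight c v
      tight-v = consecutive-tight (trans (toℕ-fromℕ< 2+e<s) (cong suc (sym τ0≡1+e)))
      preimage-is-1 : ∀ {w} → Tight c w → toℕ (τ ⟨$⟩ˡ w) ≡ 1
      preimage-is-1 t =
        tight-zero (Equivalence.from (tight-preserved τ τ-aut) (subst (Tight c) (sym (inverseʳ τ)) t))
      u≡v : u ≡ v
      u≡v = begin
        u                  ≡⟨ inverseʳ τ ⟨
        τ ⟨$⟩ʳ (τ ⟨$⟩ˡ u)  ≡⟨ cong (τ ⟨$⟩ʳ_) (toℕ-injective (trans (preimage-is-1 tight-u)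
                                                             (sym (preimage-is-1 tight-v)))) ⟩
        τ ⟨$⟩ʳ (τ ⟨$⟩ˡ v)  ≡⟨ inverseʳ τ ⟩
        v                  ∎

    endpoint : τ ⟨$⟩ʳ zero ≡ zero ⊎ τ ⟨$⟩ʳ zero ≡ opposite zero
    endpoint with toℕ (τ ⟨$⟩ʳ zero) in τ0≡
    ... | zero = inj₁ (toℕ-injective τ0≡)
    ... | suc e with suc e <? m
    ...   | yes 1+e<m = ⊥-elim (interior-not-image-of-zero τ0≡ (s≤s 1+e<m))
    ...   | no  1+e≮m = inj₂ (toℕ-injective (trans τ0≡ (trans 1+e≡m (sym (toℕ-fromℕ m)))))
      where
      1+e≡m : suc e ≡ m
      1+e≡m = ≤-antisym (≤-pred (subst (_< s) τ0≡ (toℕ<n (τ ⟨$⟩ʳ zero)))) (≮⇒≥ 1+e≮m)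

  classify : ∀ τ → IsAut n k s τ → SamePerm τ id ⊎ SamePerm τ reverse
  classify τ τ-aut with endpoint τ τ-aut
  ... | inj₁ τ0≡0   = inj₁ (fixes-all τ τ-aut τ0≡0)
  ... | inj₂ τ0≡end = inj₂ λ x →
    trans (sym (opposite-involutive (τ ⟨$⟩ʳ x))) (cong opposite (fixes-all (τ ∘ₚ reverse) σ-aut σ0≡0 x))
    where
    σ-aut : IsAut n k s (τ ∘ₚ reverse)
    σ-aut = preserves-∘ τ reverse τ-aut reverse-preserves
    σ0≡0 : opposite (τ ⟨$⟩ʳ zero) ≡ zero
    σ0≡0 = trans (cong opposite τ0≡end) (opposite-involutive zero)

  id≢reverse : ¬ SamePerm id reverse
  id≢reverse same = <⇒≢ (≤-pred 1<s) (trans (cong toℕ (same zero)) (toℕ-fromℕ m))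

  aut-has-two-elements : AutHasTwoElements n k s
  aut-has-two-elements = id , reverse , preserves-id , reverse-preserves , id≢reverse , classify

lemma3p7 : ∀ (k : ℕ) → 4 ≤ k →
    Σ ℕ λ N → ∀ (n : ℕ) .{{_ : NonZero n}} → N ≤ n →
    ∀ (s : ℕ) → 2 * k + 1 ≤ s → s < n → AutHasTwoElements n k s
lemma3p7 k 4≤k = 3 * k + 1 , aut
  where
  aut : ∀ n .{{_ : NonZero n}} → 3 * k + 1 ≤ n → ∀ s → 2 * k + 1 ≤ s → s < n → AutHasTwoElements n k s
  aut n _      zero    2k+1≤0 _   = ⊥-elim (<⇒≱ (m≤n+m 1 (2 * k)) 2k+1≤0)
  aut n 3k+1≤n (suc m) 2k+1≤s s<n = Automorphisms.aut-has-two-elements n k m 4≤k 3k+1≤n 2k+1≤s s<n
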